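{- A graph $G$ is $3$-critical (with respect to star coloring) if and only if $G$ is either $K_3$ or $P_4$.
   Context: Standing assumption of the paper: all graphs are finite, undirected, simple and connected. A star coloring of $G$ is a proper vertex-coloring such that no path on four vertices (as a subgraph, not necessarily induced) is colored with only two colors; $\chi_s(G)$, the star chromatic number, is the minimum number of colors in a star coloring of $G$. A graph $G$ is $k$-critical if $\chi_s(G)=k$ and $\chi_s(G-e)<\chi_s(G)$ for every edge $e\in E(G)$, where $G-e$ is obtained by deleting the edge $e$. $K_3$ is the complete graph on three vertices and $P_4$ is the path on four vertices. -}

module Defs where

open import Data.Nat using (ℕ; _<_)
open import Data.Fin using (Fin; zero; suc; _≟_)
open import Data.Bool using (Bool; true; false; _∧_; _∨_; not)
open import Data.Product using (Σ; ∃; _×_; _,_)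
open import Relation.Nullary using (¬_)
open import Relation.Nullary.Decidable using (⌊_⌋)
open import Relation.Binary.PropositionalEquality using (_≡_; _≢_)
open import Function.Bundles using (_↔_; Inverse)

record Graph (n : ℕ) : Set where
  field
    adj   : Fin n → Fin n → Bool
    sym   : ∀ x y → adj x y ≡ adj y x
    irrefl : ∀ x → adj x x ≡ false
open Graph public

Edge : ∀ {n} → Graph n → Set
Edge {n} G = Σ (Fin n) λ u → Σ (Fin n) λ v → adj G u v ≡ true

data Reach {n} (G : Graph n) : Fin n → Fin n → Set where
  here : ∀ {u} → Reach G u u
  step : ∀ {u w v} → adj G u w ≡ true → Reach G w v → Reach G u v

Connected : ∀ {n} → Graph n → Set
Connected {n} G = ∀ (u v : Fin n) → Reach G u v

private
  isPair : ∀ {n} → Fin n → Fin n → Fin n → Fin n → Bool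
  isPair u v x y = (⌊ x ≟ u ⌋ ∧ ⌊ y ≟ v ⌋) ∨ (⌊ x ≟ v ⌋ ∧ ⌊ y ≟ u ⌋)

deleteEdge : ∀ {n} (G : Graph n) → Edge G → Graph n
deleteEdge {n} G (u , v , _) = record
  { adj = λ x y → adj G x y ∧ not (isPair u v x y)
  ; sym = symm
  ; irrefl = λ x → irr x
  }
  where
    open import Data.Bool.Properties using (∨-comm; ∧-comm)
    open import Relation.Binary.PropositionalEquality using (cong₂; refl; trans)
    symm : ∀ x y → (adj G x y ∧ not (isPair u v x y)) ≡ (adj G y x ∧ not (isPair u v y x))
    symm x y = cong₂ (λ a b → a ∧ not b) (sym G x y) 
      (trans (∨-comm (⌊ x ≟ u ⌋ ∧ ⌊ y ≟ v ⌋) (⌊ x ≟ v ⌋ ∧ ⌊ y ≟ u ⌋))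
             (cong₂ _∨_ (∧-comm ⌊ x ≟ v ⌋ ⌊ y ≟ u ⌋) (∧-comm ⌊ x ≟ u ⌋ ⌊ y ≟ v ⌋)))
    irr : ∀ x → (adj G x x ∧ not (isPair u v x x)) ≡ false
    irr x with adj G x x | irrefl G x
    ... | false | _ = refl

Proper : ∀ {n k} → Graph n → (Fin n → Fin k) → Set
Proper {n} G col = ∀ (x y : Fin n) → adj G x y ≡ true → col x ≢ col y

-- A (not necessarily induced) path a b c d on four distinct vertices.
IsP4 : ∀ {n} → Graph n → Fin n → Fin n → Fin n → Fin n → Set
IsP4 G a b c d =
  adj G a b ≡ true × adj G b c ≡ true × adj G c d ≡ true ×
  a ≢ b × a ≢ c × a ≢ d × b ≢ c × b ≢ d × c ≢ d

-- The path is colored with only two colors (given properness this means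
-- col a = col c and col b = col d).
TwoColoredPath : ∀ {n k} → (Fin n → Fin k) → Fin n → Fin n → Fin n → Fin n → Set
TwoColoredPath col a b c d =
  Σ _ λ (p : _) → Σ _ λ (q : _) →
    (col a ≡ p ⊎' col a ≡ q) × (col b ≡ p ⊎' col b ≡ q) ×
    (col c ≡ p ⊎' col c ≡ q) × (col d ≡ p ⊎' col d ≡ q)
  where open import Data.Sum using () renaming (_⊎_ to _⊎'_)

IsStarColoring : ∀ {n k} → Graph n → (Fin n → Fin k) → Set
IsStarColoring G col =
  Proper G col ×
  (∀ a b c d → IsP4 G a b c d → ¬ TwoColoredPath col a b c d)

StarColorable : ∀ {n} → Graph n → ℕ → Set
StarColorable {n} G k = Σ (Fin n → Fin k) λ col → IsStarColoring G col

StarChromaticNumber : ∀ {n} → Graph n → ℕ → Set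
StarChromaticNumber G k = StarColorable G k × (∀ j → j < k → ¬ StarColorable G j)

Critical : ∀ {n} → ℕ → Graph n → Set
Critical k G =
  StarChromaticNumber G k ×
  (∀ (e : Edge G) → ∃ λ j → j < k × StarChromaticNumber (deleteEdge G e) j)

_≅_ : ∀ {n m} → Graph n → Graph m → Set
_≅_ {n} {m} G H = Σ (Fin n ↔ Fin m) λ f →
  ∀ x y → adj G x y ≡ adj H (Inverse.to f x) (Inverse.to f y)

K3 : Graph 3
K3 = record { adj = a ; sym = s ; irrefl = i }
  where
    open import Data.Fin using () renaming (_≟_ to _≟f_)
    open import Relation.Binary.PropositionalEquality using (refl)
    a : Fin 3 → Fin 3 → Bool
    a x y = not ⌊ x ≟f y ⌋
    s : ∀ x y → a x y ≡ a y x
    s zero zero = refl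
    s zero (suc zero) = refl
    s zero (suc (suc zero)) = refl
    s (suc zero) zero = refl
    s (suc zero) (suc zero) = refl
    s (suc zero) (suc (suc zero)) = refl
    s (suc (suc zero)) zero = refl
    s (suc (suc zero)) (suc zero) = refl
    s (suc (suc zero)) (suc (suc zero)) = refl
    i : ∀ x → a x x ≡ false
    i zero = refl
    i (suc zero) = refl
    i (suc (suc zero)) = refl

P4 : Graph 4
P4 = record { adj = a ; sym = s ; irrefl = i }
  where
    open import Data.Fin using (toℕ)
    open import Data.Nat using (suc) renaming (_≟_ to _≟n_)
    open import Relation.Binary.PropositionalEquality using (refl)
    a : Fin 4 → Fin 4 → Bool
    a x y = ⌊ toℕ x ≟n suc (toℕ y) ⌋ ∨ ⌊ toℕ y ≟n suc (toℕ x) ⌋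
    s : ∀ x y → a x y ≡ a y x
    s zero zero = refl
    s zero (suc zero) = refl
    s zero (suc (suc zero)) = refl
    s zero (suc (suc (suc zero))) = refl
    s (suc zero) zero = refl
    s (suc zero) (suc zero) = refl
    s (suc zero) (suc (suc zero)) = refl
    s (suc zero) (suc (suc (suc zero))) = refl
    s (suc (suc zero)) zero = refl
    s (suc (suc zero)) (suc zero) = refl
    s (suc (suc zero)) (suc (suc zero)) = refl
    s (suc (suc zero)) (suc (suc (suc zero))) = refl
    s (suc (suc (suc zero))) zero = refl
    s (suc (suc (suc zero))) (suc zero) = refl
    s (suc (suc (suc zero))) (suc (suc zero)) = refl
    s (suc (suc (suc zero))) (suc (suc (suc zero))) = refl
    i : ∀ x → a x x ≡ false
    i zero = refl
    i (suc zero) = refl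
    i (suc (suc zero)) = refl
    i (suc (suc (suc zero))) = refl

{-# OPTIONS --safe #-}
module Submission where

-- Three colours are forced exactly by a triangle or a P4 (a P4 coloured with
-- two colours alternates, so it is bicoloured), and a connected graph with
-- neither is a star, which two colours star-colour.  In a 3-critical graph
-- each edge must lie on every such forcing copy, since otherwise that copy
-- survives deleting the edge; by connectivity every vertex is then on the
-- copy, and G is the copy itself.  Conversely K3 and P4 are checked directly,
-- and criticality is invariant under isomorphism.

open import Defs hiding (sym)
open import Data.Nat using (ℕ; zero; suc; _<_; s≤s)
open import Data.Nat.Properties using (n<1+n; m<1+n⇒m<n∨m≡n)
open import Data.Fin using (Fin; zero; suc; _≟_)
open import Data.Fin.Patterns using (0F; 1F; 2F; 3F)
open import Data.Fin.Properties using (any?; all?; 2↔Bool)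
open import Data.Bool using (true; false; _∧_; _∨_; not; if_then_else_)
open import Data.Bool.Properties using () renaming (_≟_ to _≟ᵇ_)
open import Data.Product using (Σ; ∃; ∃₂; _×_; _,_; proj₁; proj₂; swap)
open import Data.Sum using (_⊎_; inj₁; inj₂; [_,_])
open import Data.Unit using (tt)
open import Data.Empty using (⊥-elim)
open import Function.Base using (id; _∘_; flip; case_of_)
open import Function.Bundles using (_⇔_; _↔_; Inverse; Injection; mk⇔; mk↔ₛ′)
open import Function.Properties.Inverse using (↔-sym; ↔⇒↣)
open import Relation.Nullary using (¬_; Dec; does; yes; no; contradiction)
open import Relation.Nullary.Decidable
  using (⌊_⌋; True; toWitness; dec-false; does-⇔; isYes≗does; _×-dec_; _⊎-dec_; _→-dec_; ¬?)
open import Relation.Binary.PropositionalEquality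
  using (_≡_; _≢_; refl; sym; trans; cong; cong₂; ≢-sym; module ≡-Reasoning)

private variable
  k m n : ℕ

adj-sym : (G : Graph n) {x y : Fin n} → adj G x y ≡ true → adj G y x ≡ true
adj-sym G {x} {y} = trans (Graph.sym G y x)

adj⇒≢ : (G : Graph n) {x y : Fin n} → adj G x y ≡ true → x ≢ y
adj⇒≢ G {x} xy refl = contradiction (trans (sym xy) (irrefl G x)) λ ()

deleteEdge-adj : (G : Graph n) {u v : Fin n} (uv : adj G u v ≡ true) {x y : Fin n} →
                 adj G x y ≡ true → ¬ ((x ≡ u × y ≡ v) ⊎ (x ≡ v × y ≡ u)) →
                 adj (deleteEdge G (u , v , uv)) x y ≡ true
deleteEdge-adj G {u} {v} _ {x} {y} xy ¬uv rewrite xy with x ≟ u | y ≟ v | x ≟ v | y ≟ u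
... | yes x≡u | yes y≡v | _       | _       = contradiction (inj₁ (x≡u , y≡v)) ¬uv
... | _       | _       | yes x≡v | yes y≡u = contradiction (inj₂ (x≡v , y≡u)) ¬uv
... | no _    | _       | no _    | _       = refl
... | no _    | _       | yes _   | no _    = refl
... | yes _   | no _    | no _    | _       = refl
... | yes _   | no _    | yes _   | no _    = refl

-- Embeddings as (not necessarily induced) subgraphs

record _↪_ (H : Graph k) (G : Graph n) : Set where
  field
    vertex    : Fin k → Fin n
    injective : ∀ {i j} → vertex i ≡ vertex j → i ≡ j
    preserves : ∀ {i j} → adj H i j ≡ true → adj G (vertex i) (vertex j) ≡ true
open _↪_

↪-Edge : {H : Graph k} {G : Graph n} → H ↪ G → Edge H → Edge G
↪-Edge f (i , j , ij) = vertex f i , vertex f j , preserves f ij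

↪-StarColorable : {H : Graph k} {G : Graph n} → H ↪ G → StarColorable G m → StarColorable H m
↪-StarColorable f (col , proper , star) =
  col ∘ vertex f ,
  (λ i j → proper (vertex f i) (vertex f j) ∘ preserves f) ,
  λ { a b c d (ab , bc , cd , a≢b , a≢c , a≢d , b≢c , b≢d , c≢d) →
        star (vertex f a) (vertex f b) (vertex f c) (vertex f d)
          (preserves f ab , preserves f bc , preserves f cd ,
           a≢b ∘ injective f , a≢c ∘ injective f , a≢d ∘ injective f ,
           b≢c ∘ injective f , b≢d ∘ injective f , c≢d ∘ injective f) }

↪-deleteEdge : {H : Graph k} {G : Graph n} (f : H ↪ G) {u v : Fin n} (uv : adj G u v ≡ true) →
               (∀ {i j} → adj H i j ≡ true → ¬ (vertex f i ≡ u × vertex f j ≡ v)) →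
               H ↪ deleteEdge G (u , v , uv)
↪-deleteEdge {H = H} {G} f uv avoids = record
  { vertex    = vertex f
  ; injective = injective f
  ; preserves = λ ij → deleteEdge-adj G uv (preserves f ij)
                         [ avoids ij , avoids (adj-sym H ij) ∘ swap ]
  }

-- Lower bounds and the 3-critical graphs K3 and P4

StarChromatic≥ : Graph n → ℕ → Set
StarChromatic≥ G k = ∀ j → j < k → ¬ StarColorable G j

↪-StarChromatic≥ : {H : Graph k} {G : Graph n} → H ↪ G → StarChromatic≥ H m → StarChromatic≥ G m
↪-StarChromatic≥ f H≥ j j<m = H≥ j j<m ∘ ↪-StarColorable f

StarChromatic≥-suc : {G : Graph n} → StarChromatic≥ G k → ¬ StarColorable G k →
                     StarChromatic≥ G (suc k)
StarChromatic≥-suc G≥k ¬k j j<1+k with m<1+n⇒m<n∨m≡n j<1+k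
... | inj₁ j<k  = G≥k j j<k
... | inj₂ refl = ¬k

Fin<2-unique : ∀ {j} → j < 2 → (x y : Fin j) → x ≡ y
Fin<2-unique {suc zero}    _                 zero zero = refl
Fin<2-unique {suc (suc _)} (s≤s (s≤s ())) _    _

Fin2-third : (x y z : Fin 2) → x ≢ y → y ≢ z → x ≡ z
Fin2-third 0F 1F 0F _ _ = refl
Fin2-third 1F 0F 1F _ _ = refl
Fin2-third 0F 0F _ x≢y _ = contradiction refl x≢y
Fin2-third 1F 1F _ x≢y _ = contradiction refl x≢y
Fin2-third _ 0F 0F _ y≢z = contradiction refl y≢z
Fin2-third _ 1F 1F _ y≢z = contradiction refl y≢z

edge⇒StarChromatic≥2 : (G : Graph n) {x y : Fin n} → adj G x y ≡ true → StarChromatic≥ G 2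
edge⇒StarChromatic≥2 G {x} {y} xy j j<2 (col , proper , _) =
  proper x y xy (Fin<2-unique j<2 (col x) (col y))

K3-StarChromatic≥3 : StarChromatic≥ K3 3
K3-StarChromatic≥3 = StarChromatic≥-suc {G = K3} (edge⇒StarChromatic≥2 K3 {0F} {1F} refl)
  λ (col , proper , _) → proper 0F 2F refl
    (Fin2-third (col 0F) (col 1F) (col 2F) (proper 0F 1F refl) (proper 1F 2F refl))

P4-path : IsP4 P4 0F 1F 2F 3F
P4-path = refl , refl , refl , (λ ()) , (λ ()) , (λ ()) , (λ ()) , (λ ()) , (λ ())

P4-StarChromatic≥3 : StarChromatic≥ P4 3
P4-StarChromatic≥3 = StarChromatic≥-suc {G = P4} (edge⇒StarChromatic≥2 P4 {0F} {1F} refl)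
  λ (col , proper , star) → star 0F 1F 2F 3F P4-path
    (col 0F , col 1F , inj₁ refl , inj₂ refl ,
     inj₁ (sym (Fin2-third (col 0F) (col 1F) (col 2F) (proper 0F 1F refl) (proper 1F 2F refl))) ,
     inj₂ (sym (Fin2-third (col 1F) (col 2F) (col 3F) (proper 1F 2F refl) (proper 2F 3F refl))))

isP4? : (G : Graph n) (a b c d : Fin n) → Dec (IsP4 G a b c d)
isP4? G a b c d =
  (adj G a b ≟ᵇ true) ×-dec (adj G b c ≟ᵇ true) ×-dec (adj G c d ≟ᵇ true) ×-dec
  ¬? (a ≟ b) ×-dec ¬? (a ≟ c) ×-dec ¬? (a ≟ d) ×-dec ¬? (b ≟ c) ×-dec ¬? (b ≟ d) ×-dec ¬? (c ≟ d)

twoColoredPath? : (col : Fin n → Fin k) (a b c d : Fin n) → Dec (TwoColoredPath col a b c d)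
twoColoredPath? col a b c d = any? λ p → any? λ q →
  ((col a ≟ p) ⊎-dec (col a ≟ q)) ×-dec ((col b ≟ p) ⊎-dec (col b ≟ q)) ×-dec
  ((col c ≟ p) ⊎-dec (col c ≟ q)) ×-dec ((col d ≟ p) ⊎-dec (col d ≟ q))

isStarColoring? : (G : Graph n) (col : Fin n → Fin k) → Dec (IsStarColoring G col)
isStarColoring? G col =
  (all? λ x → all? λ y → (adj G x y ≟ᵇ true) →-dec ¬? (col x ≟ col y)) ×-dec
  (all? λ a → all? λ b → all? λ c → all? λ d →
     isP4? G a b c d →-dec ¬? (twoColoredPath? col a b c d))

StarChromaticNumber≡2 : (G : Graph n) (col : Fin n → Fin 2) → True (isStarColoring? G col) →
                        (x y : Fin n) → adj G x y ≡ true → StarChromaticNumber G 2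
StarChromaticNumber≡2 G col isStar x y xy = (col , toWitness isStar) , edge⇒StarChromatic≥2 G xy

singleOut : Fin n → Fin n → Fin 2
singleOut w x = if ⌊ x ≟ w ⌋ then 1F else 0F

K3-deleteEdge : (e : Edge K3) → StarChromaticNumber (deleteEdge K3 e) 2
K3-deleteEdge (0F , 0F , ())
K3-deleteEdge e@(0F , 1F , _) = StarChromaticNumber≡2 (deleteEdge K3 e) (singleOut 2F) tt 0F 2F refl
K3-deleteEdge e@(0F , 2F , _) = StarChromaticNumber≡2 (deleteEdge K3 e) (singleOut 1F) tt 0F 1F refl
K3-deleteEdge e@(1F , 0F , _) = StarChromaticNumber≡2 (deleteEdge K3 e) (singleOut 2F) tt 0F 2F refl
K3-deleteEdge (1F , 1F , ())
K3-deleteEdge e@(1F , 2F , _) = StarChromaticNumber≡2 (deleteEdge K3 e) (singleOut 0F) tt 1F 0F refl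
K3-deleteEdge e@(2F , 0F , _) = StarChromaticNumber≡2 (deleteEdge K3 e) (singleOut 1F) tt 0F 1F refl
K3-deleteEdge e@(2F , 1F , _) = StarChromaticNumber≡2 (deleteEdge K3 e) (singleOut 0F) tt 1F 0F refl
K3-deleteEdge (2F , 2F , ())

K3-critical : Critical 3 K3
K3-critical =
  ((id , toWitness {a? = isStarColoring? K3 id} tt) , K3-StarChromatic≥3) ,
  λ e → 2 , n<1+n 2 , K3-deleteEdge e

alternating : Fin 4 → Fin 2
alternating 0F = 0F
alternating 1F = 1F
alternating 2F = 0F
alternating 3F = 1F

P4-deleteEdge : (e : Edge P4) → StarChromaticNumber (deleteEdge P4 e) 2
P4-deleteEdge (0F , 0F , ())
P4-deleteEdge e@(0F , 1F , _) = StarChromaticNumber≡2 (deleteEdge P4 e) alternating tt 1F 2F refl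
P4-deleteEdge (0F , 2F , ())
P4-deleteEdge (0F , 3F , ())
P4-deleteEdge e@(1F , 0F , _) = StarChromaticNumber≡2 (deleteEdge P4 e) alternating tt 1F 2F refl
P4-deleteEdge (1F , 1F , ())
P4-deleteEdge e@(1F , 2F , _) = StarChromaticNumber≡2 (deleteEdge P4 e) alternating tt 0F 1F refl
P4-deleteEdge (1F , 3F , ())
P4-deleteEdge (2F , 0F , ())
P4-deleteEdge e@(2F , 1F , _) = StarChromaticNumber≡2 (deleteEdge P4 e) alternating tt 0F 1F refl
P4-deleteEdge (2F , 2F , ())
P4-deleteEdge e@(2F , 3F , _) = StarChromaticNumber≡2 (deleteEdge P4 e) alternating tt 0F 1F refl
P4-deleteEdge (3F , 0F , ())
P4-deleteEdge (3F , 1F , ())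
P4-deleteEdge e@(3F , 2F , _) = StarChromaticNumber≡2 (deleteEdge P4 e) alternating tt 0F 1F refl
P4-deleteEdge (3F , 3F , ())

P4-critical : Critical 3 P4
P4-critical =
  ((colouring , toWitness {a? = isStarColoring? P4 colouring} tt) , P4-StarChromatic≥3) ,
  λ e → 2 , n<1+n 2 , P4-deleteEdge e
  where
    colouring : Fin 4 → Fin 3
    colouring 0F = 0F
    colouring 1F = 1F
    colouring 2F = 2F
    colouring 3F = 0F

-- Isomorphism invariance

≅-sym : {G : Graph n} {H : Graph m} → G ≅ H → H ≅ G
≅-sym {H = H} (φ , adj≡) = ↔-sym φ , λ x y →
  sym (trans (adj≡ (from x) (from y)) (cong₂ (adj H) (strictlyInverseˡ x) (strictlyInverseˡ y)))
  where open Inverse φ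

≅⇒↪ : {G : Graph n} {H : Graph m} → G ≅ H → G ↪ H
≅⇒↪ (φ , adj≡) = record
  { vertex    = Inverse.to φ
  ; injective = Injection.injective (↔⇒↣ φ)
  ; preserves = λ {i} {j} → trans (sym (adj≡ i j))
  }

≅-StarChromaticNumber : {G : Graph n} {H : Graph m} → G ≅ H →
                        StarChromaticNumber H k → StarChromaticNumber G k
≅-StarChromaticNumber {G = G} {H} G≅H (colourable , H≥) =
  ↪-StarColorable (≅⇒↪ {G = G} {H} G≅H) colourable ,
  ↪-StarChromatic≥ (≅⇒↪ {G = H} {G} (≅-sym {G = G} {H} G≅H)) H≥

≅-deleteEdge : {G : Graph n} {H : Graph m} (G≅H : G ≅ H) (e : Edge G) →
               deleteEdge G e ≅ deleteEdge H (↪-Edge (≅⇒↪ {G = G} {H} G≅H) e)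
≅-deleteEdge (φ , adj≡) (u , v , _) = φ , λ x y →
  cong₂ (λ a b → a ∧ not b) (adj≡ x y)
    (cong₂ _∨_ (cong₂ _∧_ (≟-to x u) (≟-to y v)) (cong₂ _∧_ (≟-to x v) (≟-to y u)))
  where
    open Inverse φ using (to)
    open ≡-Reasoning
    ≟-to : ∀ x y → ⌊ x ≟ y ⌋ ≡ ⌊ to x ≟ to y ⌋
    ≟-to x y = begin
      ⌊ x ≟ y ⌋       ≡⟨ isYes≗does (x ≟ y) ⟩
      does (x ≟ y)     ≡⟨ does-⇔ (mk⇔ (cong to) (Injection.injective (↔⇒↣ φ))) (x ≟ y) (to x ≟ to y) ⟩
      does (to x ≟ to y) ≡⟨ isYes≗does (to x ≟ to y) ⟨
      ⌊ to x ≟ to y ⌋  ∎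

Critical-≅ : {G : Graph n} {H : Graph m} → G ≅ H → Critical k H → Critical k G
Critical-≅ {G = G} {H} G≅H (χH , H-e) = ≅-StarChromaticNumber {G = G} {H} G≅H χH , λ e →
  let e′ = ↪-Edge (≅⇒↪ {G = G} {H} G≅H) e
      (j , j<k , χ) = H-e e′
  in  j , j<k , ≅-StarChromaticNumber {G = deleteEdge G e} {deleteEdge H e′}
                  (≅-deleteEdge {G = G} {H} G≅H e) χ

-- Critical graphs containing a forcing subgraph

module _ {H : Graph (suc k)} {G : Graph n} (G-connected : Connected G) (G-critical : Critical m G)
         (f : H ↪ G) (H≥ : StarChromatic≥ H m) where

  edge-image : ∀ {x y} → adj G x y ≡ true →
               ∃₂ λ i j → adj H i j ≡ true × vertex f i ≡ x × vertex f j ≡ y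
  edge-image {x} {y} xy
    with any? (λ i → any? λ j → (adj H i j ≟ᵇ true) ×-dec (vertex f i ≟ x) ×-dec (vertex f j ≟ y))
  ... | yes (i , j , ij , fi , fj) = i , j , ij , fi , fj
  ... | no none =
    let (j , j<m , colourable , _) = proj₂ G-critical (x , y , xy)
        f↪G-xy = ↪-deleteEdge f xy λ ij (fi , fj) → none (_ , _ , ij , fi , fj)
    in  ⊥-elim (H≥ j j<m (↪-StarColorable f↪G-xy colourable))

  vertex-surjective : ∀ x → ∃ λ i → vertex f i ≡ x
  vertex-surjective x with G-connected x (vertex f zero)
  ... | here      = zero , refl
  ... | step xw _ = let (i , _ , _ , fi , _) = edge-image xw in i , fi

  adj-image : ∀ i j → adj H i j ≡ adj G (vertex f i) (vertex f j)
  adj-image i j with adj H i j in ij | adj G (vertex f i) (vertex f j) in fij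
  ... | true  | _     = trans (sym (preserves f ij)) fij
  ... | false | false = refl
  ... | false | true  with edge-image fij
  ...   | _ , _ , i′j′ , fi′ , fj′ with refl ← injective f fi′ | refl ← injective f fj′ =
          contradiction (trans (sym i′j′) ij) λ ()

  Critical-↪⇒≅ : G ≅ H
  Critical-↪⇒≅ = ≅-sym {G = H} {G} (φ , adj-image)
    where
      φ : Fin (suc k) ↔ Fin n
      φ = mk↔ₛ′ (vertex f) (proj₁ ∘ vertex-surjective) (proj₂ ∘ vertex-surjective)
                (λ i → injective f (proj₂ (vertex-surjective (vertex f i))))

HasTriangle : Graph n → Set
HasTriangle {n} G = Σ (Fin n) λ a → Σ (Fin n) λ b → Σ (Fin n) λ c →
  adj G a b ≡ true × adj G b c ≡ true × adj G a c ≡ true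

HasP4 : Graph n → Set
HasP4 {n} G = Σ (Fin n) λ a → Σ (Fin n) λ b → Σ (Fin n) λ c → Σ (Fin n) λ d → IsP4 G a b c d

hasTriangle? : (G : Graph n) → Dec (HasTriangle G)
hasTriangle? G = any? λ a → any? λ b → any? λ c →
  (adj G a b ≟ᵇ true) ×-dec (adj G b c ≟ᵇ true) ×-dec (adj G a c ≟ᵇ true)

hasP4? : (G : Graph n) → Dec (HasP4 G)
hasP4? G = any? λ a → any? λ b → any? λ c → any? λ d → isP4? G a b c d

K3-adj : {i j : Fin 3} → i ≢ j → adj K3 i j ≡ true
K3-adj {i} {j} i≢j = cong not (trans (isYes≗does (i ≟ j)) (dec-false (i ≟ j) i≢j))

triangle⇒K3↪ : {G : Graph n} → HasTriangle G → K3 ↪ G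
triangle⇒K3↪ {G = G} (a , b , c , ab , bc , ac) = record
  { vertex = v ; injective = v-injective ; preserves = v-preserves }
  where
    v : Fin 3 → Fin _
    v 0F = a
    v 1F = b
    v 2F = c
    v-preserves : ∀ {i j} → adj K3 i j ≡ true → adj G (v i) (v j) ≡ true
    v-preserves {0F} {1F} _ = ab
    v-preserves {0F} {2F} _ = ac
    v-preserves {1F} {0F} _ = adj-sym G ab
    v-preserves {1F} {2F} _ = bc
    v-preserves {2F} {0F} _ = adj-sym G ac
    v-preserves {2F} {1F} _ = adj-sym G bc
    v-preserves {0F} {0F} ()
    v-preserves {1F} {1F} ()
    v-preserves {2F} {2F} ()
    v-injective : ∀ {i j} → v i ≡ v j → i ≡ j
    v-injective {i} {j} vi≡vj with i ≟ j
    ... | yes i≡j = i≡j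
    ... | no  i≢j = contradiction vi≡vj (adj⇒≢ G (v-preserves (K3-adj i≢j)))

P4⇒P4↪ : {G : Graph n} → HasP4 G → P4 ↪ G
P4⇒P4↪ {G = G} (a , b , c , d , ab , bc , cd , a≢b , a≢c , a≢d , b≢c , b≢d , c≢d) = record
  { vertex = v ; injective = v-injective ; preserves = v-preserves }
  where
    v : Fin 4 → Fin _
    v 0F = a
    v 1F = b
    v 2F = c
    v 3F = d
    v-preserves : ∀ {i j} → adj P4 i j ≡ true → adj G (v i) (v j) ≡ true
    v-preserves {0F} {1F} _ = ab
    v-preserves {1F} {0F} _ = adj-sym G ab
    v-preserves {1F} {2F} _ = bc
    v-preserves {2F} {1F} _ = adj-sym G bc
    v-preserves {2F} {3F} _ = cd
    v-preserves {3F} {2F} _ = adj-sym G cd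
    v-preserves {0F} {0F} ()
    v-preserves {0F} {2F} ()
    v-preserves {0F} {3F} ()
    v-preserves {1F} {1F} ()
    v-preserves {1F} {3F} ()
    v-preserves {2F} {0F} ()
    v-preserves {2F} {2F} ()
    v-preserves {3F} {0F} ()
    v-preserves {3F} {1F} ()
    v-preserves {3F} {3F} ()
    v-injective : ∀ {i j} → v i ≡ v j → i ≡ j
    v-injective {0F} {0F} _ = refl
    v-injective {1F} {1F} _ = refl
    v-injective {2F} {2F} _ = refl
    v-injective {3F} {3F} _ = refl
    v-injective {0F} {1F} = flip contradiction a≢b
    v-injective {0F} {2F} = flip contradiction a≢c
    v-injective {0F} {3F} = flip contradiction a≢d
    v-injective {1F} {2F} = flip contradiction b≢c
    v-injective {1F} {3F} = flip contradiction b≢d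
    v-injective {2F} {3F} = flip contradiction c≢d
    v-injective {1F} {0F} = flip contradiction (≢-sym a≢b)
    v-injective {2F} {0F} = flip contradiction (≢-sym a≢c)
    v-injective {3F} {0F} = flip contradiction (≢-sym a≢d)
    v-injective {2F} {1F} = flip contradiction (≢-sym b≢c)
    v-injective {3F} {1F} = flip contradiction (≢-sym b≢d)
    v-injective {3F} {2F} = flip contradiction (≢-sym c≢d)

-- Connected graphs without triangles and P4s

module _ {G : Graph n} (G-connected : Connected G)
         (no-triangle : ¬ HasTriangle G) (no-P4 : ¬ HasP4 G) (v₀ : Fin n) where

  within-distance-2 : ∀ {x} → Reach G x v₀ →
    x ≡ v₀ ⊎ adj G x v₀ ≡ true ⊎ ∃ λ w → adj G x w ≡ true × adj G w v₀ ≡ true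
  within-distance-2 here = inj₁ refl
  within-distance-2 {x} (step {w = w} xw w⇝v₀) with within-distance-2 w⇝v₀
  ... | inj₁ refl        = inj₂ (inj₁ xw)
  ... | inj₂ (inj₁ wv₀) = inj₂ (inj₂ (w , xw , wv₀))
  ... | inj₂ (inj₂ (w′ , ww′ , w′v₀)) with x ≟ v₀ | x ≟ w′ | w ≟ v₀
  ...   | yes x≡v₀ | _        | _      = inj₁ x≡v₀
  ...   | no _     | yes refl | _      = inj₂ (inj₁ w′v₀)
  ...   | no _     | no _     | yes refl = inj₂ (inj₁ xw)
  ...   | no x≢v₀  | no x≢w′  | no w≢v₀ = contradiction
          (x , w , w′ , v₀ , xw , ww′ , w′v₀ , adj⇒≢ G xw , x≢w′ , x≢v₀ , adj⇒≢ G ww′ , w≢v₀ , adj⇒≢ G w′v₀)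
          no-P4

  adj-v₀-alternates : ∀ {x y} → adj G x y ≡ true → adj G x v₀ ≢ adj G y v₀
  adj-v₀-alternates {x} {y} xy with adj G x v₀ in xv₀
  ... | true  = λ yv₀ → no-triangle (x , y , v₀ , xy , sym yv₀ , xv₀)
  ... | false = λ yv₀ → case within-distance-2 (G-connected x v₀) of λ where
    (inj₁ refl) → contradiction (trans (sym (adj-sym G xy)) (sym yv₀)) λ ()
    (inj₂ (inj₁ xv₀′)) → contradiction (trans (sym xv₀′) xv₀) λ ()
    (inj₂ (inj₂ (w , xw , wv₀))) → no-P4 (y , x , w , v₀ , adj-sym G xy , xw , wv₀ ,
       adj⇒≢ G (adj-sym G xy) , (λ { refl → contradiction (trans yv₀ wv₀) λ () }) ,
       (λ { refl → contradiction (trans (sym xy) xv₀) λ () }) ,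
       adj⇒≢ G xw , (λ { refl → contradiction (trans yv₀ (adj-sym G xy)) λ () }) , adj⇒≢ G wv₀)

P4-free⇒StarColorable2 : {G : Graph n} → Connected G → ¬ HasTriangle G → ¬ HasP4 G →
                         StarColorable G 2
P4-free⇒StarColorable2 {zero}  _ _ _ = (λ ()) , (λ ()) , λ ()
P4-free⇒StarColorable2 {suc _} {G} G-connected no-triangle no-P4 =
  colour , proper , λ a b c d P _ → no-P4 (a , b , c , d , P)
  where
    colour : Fin _ → Fin 2
    colour x = Inverse.from 2↔Bool (adj G x 0F)
    proper : Proper G colour
    proper x y xy = adj-v₀-alternates G-connected no-triangle no-P4 0F xy
                  ∘ Injection.injective (↔⇒↣ (↔-sym 2↔Bool))

mainTheorem1 : ∀ (n : ℕ) (G : Graph n) → Connected G →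
    (Critical 3 G ⇔ (G ≅ K3 ⊎ G ≅ P4))
mainTheorem1 n G G-connected = mk⇔ critical⇒K3⊎P4
  [ (λ G≅K3 → Critical-≅ {G = G} {K3} G≅K3 K3-critical)
  , (λ G≅P4 → Critical-≅ {G = G} {P4} G≅P4 P4-critical) ]
  where
    critical⇒K3⊎P4 : Critical 3 G → G ≅ K3 ⊎ G ≅ P4
    critical⇒K3⊎P4 G-critical with hasTriangle? G | hasP4? G
    ... | yes triangle   | _ =
      inj₁ (Critical-↪⇒≅ G-connected G-critical (triangle⇒K3↪ triangle) K3-StarChromatic≥3)
    ... | no _           | yes p4 =
      inj₂ (Critical-↪⇒≅ G-connected G-critical (P4⇒P4↪ p4) P4-StarChromatic≥3)
    ... | no no-triangle | no no-P4 =
      contradiction (P4-free⇒StarColorable2 G-connected no-triangle no-P4)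
                    (proj₂ (proj₁ G-critical) 2 (n<1+n 2))
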